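{- For integers $0\le k\le m\le n$, there is a bijection between the set of free Dyck paths of length $2n$ with $m$ flaws in $k$ flaw blocks and the set of doubly rooted plane trees with $n$ edges, stem size $k$ and $m$ prefix edges.
   Context: A free Dyck path of length $2n$ is a lattice path from $(0,0)$ to $(2n,0)$ with $n$ up steps $(1,1)$ and $n$ down steps $(1,-1)$. It has $m$ flaws if exactly $m$ of its up steps lie below the $x$-axis (go from height $-j$ to $-j+1$ with $j\ge1$). A flaw block is a maximal segment of the path that starts and ends on the $x$-axis and is otherwise strictly below it (a negative elevated Dyck path); the number of flaw blocks equals the number of down steps going from height $0$ to height $-1$. A doubly rooted plane tree is a plane tree (rooted, children linearly ordered) with a distinguished vertex $w$. Its stem is the path from the root to $w$; the stem size is the number of edges of the stem. Label the vertices $0,1,\dots,n$ in right-to-left preorder (visit the root, then recursively the subtrees of the root from rightmost to leftmost); an edge is a prefix edge if it lies on the stem or to the right of the stem, equivalently if its lower endpoint has label at most the label of $w$. -}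

module Defs where

open import Data.Nat using (ℕ; zero; suc; _+_; _*_; _≤_; _≤?_)
open import Data.Integer as ℤ using (ℤ; 0ℤ; 1ℤ; _<?_)
open import Data.List using (List; []; _∷_; length; map; _++_; filter)
open import Data.Product using (Σ; _×_; _,_)
open import Relation.Binary.PropositionalEquality using (_≡_)
open import Relation.Nullary using (does)
open import Data.Bool using (if_then_else_)

data Step : Set where
  U D : Step   -- U = up step (1,1), D = down step (1,-1)

ups : List Step → ℕ
ups []      = 0
ups (U ∷ s) = suc (ups s)
ups (D ∷ s) = ups s

FreeDyckPath : ℕ → Set
FreeDyckPath n = Σ (List Step) (λ s → (length s ≡ 2 * n) × (ups s ≡ n))

-- flaws of the remaining steps when the current height is h:
-- up steps starting at height -j with j ≥ 1 (i.e. h < 0)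
flawsFrom : ℤ → List Step → ℕ
flawsFrom h []      = 0
flawsFrom h (U ∷ s) = (if does (h <? 0ℤ) then 1 else 0) + flawsFrom (h ℤ.+ 1ℤ) s
flawsFrom h (D ∷ s) = flawsFrom (h ℤ.- 1ℤ) s

flaws : List Step → ℕ
flaws = flawsFrom 0ℤ

-- flaw blocks = number of down steps from height 0 to height -1
blocksFrom : ℤ → List Step → ℕ
blocksFrom h []      = 0
blocksFrom h (U ∷ s) = blocksFrom (h ℤ.+ 1ℤ) s
blocksFrom h (D ∷ s) = (if does (h ℤ.≟ 0ℤ) then 1 else 0) + blocksFrom (h ℤ.- 1ℤ) s

flawBlocks : List Step → ℕ
flawBlocks = blocksFrom 0ℤ

FreeDyck : (n m k : ℕ) → Set
FreeDyck n m k =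
  Σ (List Step) (λ s → (length s ≡ 2 * n) × (ups s ≡ n)
                       × (flaws s ≡ m) × (flawBlocks s ≡ k))

-- Plane trees (children listed left to right)

data Tree : Set where
  node : List Tree → Tree

mutual
  edges : Tree → ℕ
  edges (node ts) = edgesL ts

  -- edges in a forest hanging from a common parent, including the
  -- edges from that parent to the roots of the forest
  edgesL : List Tree → ℕ
  edgesL []       = 0
  edgesL (t ∷ ts) = suc (edges t) + edgesL ts

verticesL : List Tree → ℕ
verticesL []       = 0
verticesL (t ∷ ts) = suc (edges t) + verticesL ts

-- vertices of a tree (as positions = paths from the root)
mutual
  data Pos : Tree → Set where
    here : ∀ {ts} → Pos (node ts)
    down : ∀ {ts} → PosL ts → Pos (node ts)

  data PosL : List Tree → Set where
    hd : ∀ {t ts} → Pos t → PosL (t ∷ ts)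
    tl : ∀ {t ts} → PosL ts → PosL (t ∷ ts)

-- depth of a vertex = number of edges from the root (stem size)
mutual
  depth : ∀ {t} → Pos t → ℕ
  depth here     = 0
  depth (down q) = suc (depthL q)

  depthL : ∀ {ts} → PosL ts → ℕ
  depthL (hd p) = depth p
  depthL (tl q) = depthL q

-- label in right-to-left preorder: root gets 0, then the subtrees of the
-- root from rightmost to leftmost.  A vertex in the i-th child subtree is
-- preceded by the root and all vertices of the subtrees to its right.
mutual
  label : ∀ {t} → Pos t → ℕ
  label here     = 0
  label (down q) = suc (labelL q)

  labelL : ∀ {ts} → PosL ts → ℕ
  labelL {t ∷ ts} (hd p) = verticesL ts + label p
  labelL (tl q)          = labelL q

mutual
  positions : (t : Tree) → List (Pos t)
  positions (node ts) = here ∷ map down (positionsL ts)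

  positionsL : (ts : List Tree) → List (PosL ts)
  positionsL []       = []
  positionsL (t ∷ ts) = map hd (positions t) ++ map tl (positionsL ts)

-- non-root vertices (each is the lower endpoint of exactly one edge)
nonRoot : (t : Tree) → List (Pos t)
nonRoot (node ts) = map down (positionsL ts)

prefixEdges : (t : Tree) → Pos t → ℕ
prefixEdges t w = length (filter (λ p → label p ≤? label w) (nonRoot t))

DRTree : (n k m : ℕ) → Set
DRTree n k m =
  Σ Tree (λ t → Σ (Pos t) (λ w →
     (edges t ≡ n) × (depth w ≡ k) × (prefixEdges t w ≡ m)))

-- A doubly rooted tree (t , w) is encoded by walking down its stem.  If w is the
-- root, write the Dyck path of the root's subtrees.  Otherwise the stem leaves the
-- root through a child c, the children being ls ++ c ∷ rs: write the Dyck path of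
-- the forest ls above the axis, then the tree node rs hung below the axis (a down
-- step, the mirrored Dyck path of rs, an up step), and continue from c.  Each stem
-- edge opens exactly one flaw block, and the flaws are the up steps below the axis:
-- one per stem edge and one per edge right of the stem.  In right-to-left preorder
-- that is the label of w, which is also its number of prefix edges.  A free Dyck
-- path is decoded by reading a maximal forest above the axis, a maximal forest
-- below it, and recursing after the up step that returns to the axis.

module Submission where

open import Defs
open import Data.Nat using (ℕ; _≤_)
open import Function.Bundles using (_⤖_)

open import Data.Nat using (zero; suc; _+_; _*_; _<_; _⊓_; z≤n; s≤s; s≤s⁻¹; _≤?_; _<?_)
open import Data.Nat.Properties
open import Algebra.Properties.CommutativeSemigroup +-commutativeSemigroup using (x∙yz≈y∙xz)
open import Data.Integer as ℤ using (-[1+_])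
open import Data.List using (List; []; _∷_; [_]; length; map; filter; _++_)
open import Data.List.Properties using (length-++; length-map; map-++; map-∘; filter-++; filter-accept; filter-none; filter-≐)
open import Data.List.Relation.Unary.All using (universal)
open import Data.Product using (Σ; _×_; _,_; proj₁; proj₂; uncurry; map₁)
open import Data.Bool using (true; false)
open import Data.Empty using (⊥-elim)
open import Function using (_∘_)
open import Function.Bundles using (mk↔ₛ′)
open import Function.Properties.Inverse using (↔⇒⤖)
open import Level using (0ℓ)
open import Relation.Nullary using (¬_; does; yes; no)
open import Relation.Unary using (Pred; Decidable; _≐_)
open import Relation.Binary.PropositionalEquality hiding ([_])

count : Step → List Step → ℕ
count x       []      = 0
count U (U ∷ s) = suc (count U s)
count U (D ∷ s) = count U s
count D (U ∷ s) = count D s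
count D (D ∷ s) = suc (count D s)

ups≡count : ∀ s → ups s ≡ count U s
ups≡count []      = refl
ups≡count (U ∷ s) = cong suc (ups≡count s)
ups≡count (D ∷ s) = ups≡count s

length≡count+count : ∀ s → length s ≡ count U s + count D s
length≡count+count []      = refl
length≡count+count (U ∷ s) = cong suc (length≡count+count s)
length≡count+count (D ∷ s) = trans (cong suc (length≡count+count s)) (sym (+-suc _ _))

Rises : ℕ → List Step → Set
Rises d s = count U s ≡ d + count D s

-- Dyck words of forests

data Orientation : Set where
  above below : Orientation

opening closing : Orientation → Step
opening above = U
opening below = D
closing above = D
closing below = U

data Reading (σ : Orientation) : Step → Set where
  opens  : Reading σ (opening σ)
  closes : Reading σ (closing σ)

read : ∀ σ x → Reading σ x
read above U = opens
read above D = closes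
read below U = closes
read below D = opens

read-opening : ∀ σ → read σ (opening σ) ≡ opens
read-opening above = refl
read-opening below = refl

read-closing : ∀ σ → read σ (closing σ) ≡ closes
read-closing above = refl
read-closing below = refl

count-opening-∷ : ∀ σ s → count (opening σ) (opening σ ∷ s) ≡ suc (count (opening σ) s)
count-opening-∷ above s = refl
count-opening-∷ below s = refl

count-closing-∷ : ∀ σ s → count (closing σ) (opening σ ∷ s) ≡ count (closing σ) s
count-closing-∷ above s = refl
count-closing-∷ below s = refl

mutual
  encodeForest : Orientation → List Tree → List Step → List Step
  encodeForest σ []       r = r
  encodeForest σ (t ∷ ts) r = encodeTree σ t (encodeForest σ ts r)

  encodeTree : Orientation → Tree → List Step → List Step
  encodeTree σ (node ts) r = opening σ ∷ encodeForest σ ts (closing σ ∷ r)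

encodeForest-++ : ∀ σ ls rs r → encodeForest σ (ls ++ rs) r ≡ encodeForest σ ls (encodeForest σ rs r)
encodeForest-++ σ []       rs r = refl
encodeForest-++ σ (t ∷ ls) rs r = cong (encodeTree σ t) (encodeForest-++ σ ls rs r)

mutual
  count-encodeForest : ∀ σ x ts r → count x (encodeForest σ ts r) ≡ edgesL ts + count x r
  count-encodeForest σ x []       r = refl
  count-encodeForest σ x (t ∷ ts) r = begin
    count x (encodeTree σ t (encodeForest σ ts r))  ≡⟨ count-encodeTree σ x t _ ⟩
    suc (edges t) + count x (encodeForest σ ts r)   ≡⟨ cong (suc (edges t) +_) (count-encodeForest σ x ts r) ⟩
    suc (edges t) + (edgesL ts + count x r)         ≡⟨ +-assoc (suc (edges t)) _ _ ⟨
    edgesL (t ∷ ts) + count x r                     ∎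
    where open ≡-Reasoning

  count-encodeTree : ∀ σ x t r → count x (encodeTree σ t r) ≡ suc (edges t) + count x r
  count-encodeTree above U (node ts) r = cong suc (count-encodeForest above U ts (D ∷ r))
  count-encodeTree above D (node ts) r = trans (count-encodeForest above D ts (D ∷ r)) (+-suc _ _)
  count-encodeTree below U (node ts) r = trans (count-encodeForest below U ts (U ∷ r)) (+-suc _ _)
  count-encodeTree below D (node ts) r = cong suc (count-encodeForest below D ts (U ∷ r))

rises-encodeForest : ∀ {d} σ ts r → Rises d (encodeForest σ ts r) → Rises d r
rises-encodeForest {d} σ ts r rises = +-cancelˡ-≡ (edgesL ts) _ _ (begin
  edgesL ts + count U r                ≡⟨ count-encodeForest σ U ts r ⟨
  count U (encodeForest σ ts r)        ≡⟨ rises ⟩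
  d + count D (encodeForest σ ts r)    ≡⟨ cong (d +_) (count-encodeForest σ D ts r) ⟩
  d + (edgesL ts + count D r)          ≡⟨ x∙yz≈y∙xz d (edgesL ts) (count D r) ⟩
  edgesL ts + (d + count D r)          ∎)
  where open ≡-Reasoning

edgesL≤length-encodeForest : ∀ σ ts r → edgesL ts ≤ length (encodeForest σ ts r)
edgesL≤length-encodeForest σ ts r = begin
  edgesL ts                                                     ≤⟨ m≤m+n _ _ ⟩
  edgesL ts + count U r                                         ≡⟨ count-encodeForest σ U ts r ⟨
  count U (encodeForest σ ts r)                                 ≤⟨ m≤m+n _ _ ⟩
  count U (encodeForest σ ts r) + count D (encodeForest σ ts r) ≡⟨ length≡count+count (encodeForest σ ts r) ⟨
  length (encodeForest σ ts r)                                  ∎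
  where open ≤-Reasoning

length≤length-encodeForest : ∀ σ ts r → length r ≤ length (encodeForest σ ts r)
length≤length-encodeForest σ ts r = begin
  length r                                                      ≡⟨ length≡count+count r ⟩
  count U r + count D r                                         ≤⟨ +-mono-≤ (m≤n+m _ (edgesL ts)) (m≤n+m _ (edgesL ts)) ⟩
  (edgesL ts + count U r) + (edgesL ts + count D r)             ≡⟨ cong₂ _+_ (count-encodeForest σ U ts r) (count-encodeForest σ D ts r) ⟨
  count U (encodeForest σ ts r) + count D (encodeForest σ ts r) ≡⟨ length≡count+count (encodeForest σ ts r) ⟨
  length (encodeForest σ ts r)                                  ∎
  where open ≤-Reasoning

-- Parsing

-- parseForest σ f s splits s into the longest prefix that encodes a forest of
-- orientation σ and the rest; the fuel f suffices once length s ≤ f.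
mutual
  parseForest : Orientation → ℕ → List Step → List Tree × List Step
  parseForest σ zero    s       = [] , s
  parseForest σ (suc f) []      = [] , []
  parseForest σ (suc f) (x ∷ s) = parseFrom σ f s (read σ x)

  parseFrom : ∀ σ {x} → ℕ → List Step → Reading σ x → List Tree × List Step
  parseFrom σ f s closes = [] , closing σ ∷ s
  parseFrom σ f s opens  = parseArch σ f s (parseForest σ f s)

  parseArch : Orientation → ℕ → List Step → List Tree × List Step → List Tree × List Step
  parseArch σ f s (ts , [])    = [] , opening σ ∷ s
  parseArch σ f s (ts , x ∷ r) = parseClosing σ f s ts r (read σ x)

  parseClosing : ∀ σ {x} → ℕ → List Step → List Tree → List Step → Reading σ x → List Tree × List Step
  parseClosing σ f s ts r opens  = [] , opening σ ∷ s
  parseClosing σ f s ts r closes = map₁ (node ts ∷_) (parseForest σ f r)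

mutual
  encodeForest-parseForest : ∀ σ f s → uncurry (encodeForest σ) (parseForest σ f s) ≡ s
  encodeForest-parseForest σ zero    s       = refl
  encodeForest-parseForest σ (suc f) []      = refl
  encodeForest-parseForest σ (suc f) (x ∷ s) = encodeForest-parseFrom σ f s (read σ x)

  encodeForest-parseFrom : ∀ σ {x} f s (v : Reading σ x) → uncurry (encodeForest σ) (parseFrom σ f s v) ≡ x ∷ s
  encodeForest-parseFrom σ f s closes = refl
  encodeForest-parseFrom σ f s opens  =
    encodeForest-parseArch σ f s (parseForest σ f s) (encodeForest-parseForest σ f s)

  encodeForest-parseArch : ∀ σ f s res → uncurry (encodeForest σ) res ≡ s →
                           uncurry (encodeForest σ) (parseArch σ f s res) ≡ opening σ ∷ s
  encodeForest-parseArch σ f s (ts , [])    _ = refl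
  encodeForest-parseArch σ f s (ts , x ∷ r) e = encodeForest-parseClosing σ f s ts r (read σ x) e

  encodeForest-parseClosing : ∀ σ {x} f s ts r (v : Reading σ x) → encodeForest σ ts (x ∷ r) ≡ s →
                              uncurry (encodeForest σ) (parseClosing σ f s ts r v) ≡ opening σ ∷ s
  encodeForest-parseClosing σ f s ts r opens  _ = refl
  encodeForest-parseClosing σ f s ts r closes e =
    cong (opening σ ∷_) (trans (cong (λ r′ → encodeForest σ ts (closing σ ∷ r′)) (encodeForest-parseForest σ f r)) e)

data Stops (σ : Orientation) : List Step → Set where
  end       : Stops σ []
  atClosing : ∀ {r} → Stops σ (closing σ ∷ r)

¬Stops-opening : ∀ σ {r} → ¬ Stops σ (opening σ ∷ r)
¬Stops-opening above ()
¬Stops-opening below ()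

parseForest-encodeForest : ∀ σ f ts r → edgesL ts ≤ f → Stops σ r → parseForest σ f (encodeForest σ ts r) ≡ (ts , r)
parseForest-encodeForest σ zero    []             r _        _         = refl
parseForest-encodeForest σ (suc f) []             r _        end       = refl
parseForest-encodeForest σ (suc f) []             r _        atClosing = cong (parseFrom σ f _) (read-closing σ)
parseForest-encodeForest σ (suc f) (node cs ∷ ts) r (s≤s le) stops     = begin
  parseFrom σ f inner (read σ (opening σ))                 ≡⟨ cong (parseFrom σ f inner) (read-opening σ) ⟩
  parseArch σ f inner (parseForest σ f inner)              ≡⟨ cong (parseArch σ f inner) (parseForest-encodeForest σ f cs _ (m+n≤o⇒m≤o _ le) atClosing) ⟩
  parseClosing σ f inner cs rest (read σ (closing σ))      ≡⟨ cong (parseClosing σ f inner cs rest) (read-closing σ) ⟩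
  map₁ (node cs ∷_) (parseForest σ f rest)                 ≡⟨ cong (map₁ (node cs ∷_)) (parseForest-encodeForest σ f ts r (m+n≤o⇒n≤o _ le) stops) ⟩
  (node cs ∷ ts , r)                                       ∎
  where
    open ≡-Reasoning
    rest inner : List Step
    rest  = encodeForest σ ts r
    inner = encodeForest σ cs (closing σ ∷ rest)

-- The remainders parseForest can leave; in the unmatched case the tail after the
-- opening step never comes back down to the level where that step starts.
data Halted (σ : Orientation) : List Step → Set where
  stopped   : ∀ {r} → Stops σ r → Halted σ r
  unmatched : ∀ {r} → count (closing σ) r ≤ count (opening σ) r → Halted σ (opening σ ∷ r)

unmatched-encodeForest : ∀ σ ts r → count (closing σ) r ≤ count (opening σ) r →
                         Halted σ (opening σ ∷ encodeForest σ ts (opening σ ∷ r))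
unmatched-encodeForest σ ts r le = unmatched (begin
  count (closing σ) (encodeForest σ ts (opening σ ∷ r)) ≡⟨ count-encodeForest σ (closing σ) ts _ ⟩
  edgesL ts + count (closing σ) (opening σ ∷ r)         ≡⟨ cong (edgesL ts +_) (count-closing-∷ σ r) ⟩
  edgesL ts + count (closing σ) r                       ≤⟨ +-monoʳ-≤ (edgesL ts) (m≤n⇒m≤1+n le) ⟩
  edgesL ts + suc (count (opening σ) r)                 ≡⟨ cong (edgesL ts +_) (count-opening-∷ σ r) ⟨
  edgesL ts + count (opening σ) (opening σ ∷ r)         ≡⟨ count-encodeForest σ (opening σ) ts _ ⟨
  count (opening σ) (encodeForest σ ts (opening σ ∷ r)) ∎)
  where open ≤-Reasoning

mutual
  parseForest-halted : ∀ σ f s → length s ≤ f → Halted σ (proj₂ (parseForest σ f s))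
  parseForest-halted σ zero    []      _        = stopped end
  parseForest-halted σ (suc f) []      _        = stopped end
  parseForest-halted σ (suc f) (x ∷ s) (s≤s le) = parseFrom-halted σ f s (read σ x) le

  parseFrom-halted : ∀ σ {x} f s (v : Reading σ x) → length s ≤ f → Halted σ (proj₂ (parseFrom σ f s v))
  parseFrom-halted σ f s closes le = stopped atClosing
  parseFrom-halted σ f s opens  le =
    parseArch-halted σ f s (parseForest σ f s) (encodeForest-parseForest σ f s) (parseForest-halted σ f s le) le

  parseArch-halted : ∀ σ f s res → uncurry (encodeForest σ) res ≡ s → Halted σ (proj₂ res) → length s ≤ f →
                     Halted σ (proj₂ (parseArch σ f s res))
  parseArch-halted σ f s (ts , [])    refl _ _ =
    unmatched (≤-reflexive (trans (count-encodeForest σ (closing σ) ts []) (sym (count-encodeForest σ (opening σ) ts []))))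
  parseArch-halted σ f s (ts , x ∷ r) e    h le = parseClosing-halted σ f s ts r (read σ x) e h le

  parseClosing-halted : ∀ σ {x} f s ts r (v : Reading σ x) → encodeForest σ ts (x ∷ r) ≡ s → Halted σ (x ∷ r) →
                        length s ≤ f → Halted σ (proj₂ (parseClosing σ f s ts r v))
  parseClosing-halted σ f s ts r opens  refl (stopped stops) _ = ⊥-elim (¬Stops-opening σ stops)
  parseClosing-halted σ f s ts r opens  refl (unmatched le)  _ = unmatched-encodeForest σ ts r le
  parseClosing-halted σ f s ts r closes refl _ le =
    parseForest-halted σ f r (≤-trans (n≤1+n _) (≤-trans (length≤length-encodeForest σ ts (closing σ ∷ r)) le))

halted-balanced : ∀ σ {r} → Halted σ r → count (opening σ) r ≤ count (closing σ) r → Stops σ r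
halted-balanced σ (stopped stops) _ = stops
halted-balanced σ (unmatched {r} le) ge = ⊥-elim (1+n≰n (begin
  suc (count (opening σ) r)             ≡⟨ count-opening-∷ σ r ⟨
  count (opening σ) (opening σ ∷ r)     ≤⟨ ge ⟩
  count (closing σ) (opening σ ∷ r)     ≡⟨ count-closing-∷ σ r ⟩
  count (closing σ) r                   ≤⟨ le ⟩
  count (opening σ) r                   ∎))
  where open ≤-Reasoning

-- Flaws and flaw blocks of the encoding

mutual
  encode : (t : Tree) → Pos t → List Step
  encode (node ts) here     = encodeForest above ts []
  encode (node ts) (down q) = encodeL q

  encodeL : ∀ {ts} → PosL ts → List Step
  encodeL (hd {t} {ts} w) = encodeTree below (node ts) (encode t w)
  encodeL (tl {t} q)      = encodeTree above t (encodeL q)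

edgesL≡verticesL : ∀ ts → edgesL ts ≡ verticesL ts
edgesL≡verticesL []       = refl
edgesL≡verticesL (t ∷ ts) = cong (suc (edges t) +_) (edgesL≡verticesL ts)

mutual
  count-encode : ∀ x t (w : Pos t) → count x (encode t w) ≡ edges t
  count-encode x (node ts) here     = trans (count-encodeForest above x ts []) (+-identityʳ _)
  count-encode x (node ts) (down q) = count-encodeL x q

  count-encodeL : ∀ x {ts} (q : PosL ts) → count x (encodeL q) ≡ edgesL ts
  count-encodeL x (hd {t} {ts} w) = begin
    count x (encodeTree below (node ts) (encode t w)) ≡⟨ count-encodeTree below x (node ts) _ ⟩
    suc (edgesL ts) + count x (encode t w)            ≡⟨ cong (suc (edgesL ts) +_) (count-encode x t w) ⟩
    suc (edgesL ts + edges t)                         ≡⟨ cong suc (+-comm (edgesL ts) _) ⟩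
    suc (edges t + edgesL ts)                         ∎
    where open ≡-Reasoning
  count-encodeL x (tl {t} q) = trans (count-encodeTree above x t _) (cong (suc (edges t) +_) (count-encodeL x q))

-- The height tests in flawsFrom and blocksFrom are stuck on n + 1 and n + 0, which
-- do not compute for a variable n.
flawsFrom-D : ∀ n r → flawsFrom (ℤ.+ (n + 1)) (D ∷ r) ≡ flawsFrom (ℤ.+ n) r
flawsFrom-D n r rewrite +-comm n 1 = refl

blocksFrom-D : ∀ n r → blocksFrom (ℤ.+ (n + 1)) (D ∷ r) ≡ blocksFrom (ℤ.+ n) r
blocksFrom-D n r rewrite +-comm n 1 = refl

flawsFrom-D-negative : ∀ n r → flawsFrom -[1+ n ] (D ∷ r) ≡ flawsFrom -[1+ suc n ] r
flawsFrom-D-negative n r rewrite +-identityʳ n = refl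

blocksFrom-D-negative : ∀ n r → blocksFrom -[1+ n ] (D ∷ r) ≡ blocksFrom -[1+ suc n ] r
blocksFrom-D-negative n r rewrite +-identityʳ n = refl

mutual
  flawsFrom-encodeForest-above : ∀ n ts r → flawsFrom (ℤ.+ n) (encodeForest above ts r) ≡ flawsFrom (ℤ.+ n) r
  flawsFrom-encodeForest-above n []       r = refl
  flawsFrom-encodeForest-above n (t ∷ ts) r =
    trans (flawsFrom-encodeTree-above n t _) (flawsFrom-encodeForest-above n ts r)

  flawsFrom-encodeTree-above : ∀ n t r → flawsFrom (ℤ.+ n) (encodeTree above t r) ≡ flawsFrom (ℤ.+ n) r
  flawsFrom-encodeTree-above n (node ts) r =
    trans (flawsFrom-encodeForest-above (n + 1) ts (D ∷ r)) (flawsFrom-D n r)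

mutual
  blocksFrom-encodeForest-above : ∀ n ts r → blocksFrom (ℤ.+ n) (encodeForest above ts r) ≡ blocksFrom (ℤ.+ n) r
  blocksFrom-encodeForest-above n []       r = refl
  blocksFrom-encodeForest-above n (t ∷ ts) r =
    trans (blocksFrom-encodeTree-above n t _) (blocksFrom-encodeForest-above n ts r)

  blocksFrom-encodeTree-above : ∀ n t r → blocksFrom (ℤ.+ n) (encodeTree above t r) ≡ blocksFrom (ℤ.+ n) r
  blocksFrom-encodeTree-above n (node ts) r =
    trans (blocksFrom-encodeForest-above (n + 1) ts (D ∷ r)) (blocksFrom-D n r)

mutual
  flawsFrom-encodeForest-below : ∀ n ts r → flawsFrom -[1+ n ] (encodeForest below ts r) ≡ edgesL ts + flawsFrom -[1+ n ] r
  flawsFrom-encodeForest-below n []       r = refl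
  flawsFrom-encodeForest-below n (t ∷ ts) r = begin
    flawsFrom -[1+ n ] (encodeTree below t (encodeForest below ts r)) ≡⟨ flawsFrom-encodeTree-below n t _ ⟩
    suc (edges t) + flawsFrom -[1+ n ] (encodeForest below ts r)      ≡⟨ cong (suc (edges t) +_) (flawsFrom-encodeForest-below n ts r) ⟩
    suc (edges t) + (edgesL ts + flawsFrom -[1+ n ] r)                ≡⟨ +-assoc (suc (edges t)) _ _ ⟨
    edgesL (t ∷ ts) + flawsFrom -[1+ n ] r                            ∎
    where open ≡-Reasoning

  flawsFrom-encodeTree-below : ∀ n t r → flawsFrom -[1+ n ] (encodeTree below t r) ≡ suc (edges t) + flawsFrom -[1+ n ] r
  flawsFrom-encodeTree-below n (node ts) r = begin
    flawsFrom -[1+ n ] (D ∷ encodeForest below ts (U ∷ r))   ≡⟨ flawsFrom-D-negative n (encodeForest below ts (U ∷ r)) ⟩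
    flawsFrom -[1+ suc n ] (encodeForest below ts (U ∷ r))   ≡⟨ flawsFrom-encodeForest-below (suc n) ts (U ∷ r) ⟩
    edgesL ts + suc (flawsFrom -[1+ n ] r)                   ≡⟨ +-suc (edgesL ts) _ ⟩
    suc (edgesL ts) + flawsFrom -[1+ n ] r                   ∎
    where open ≡-Reasoning

mutual
  blocksFrom-encodeForest-below : ∀ n ts r → blocksFrom -[1+ n ] (encodeForest below ts r) ≡ blocksFrom -[1+ n ] r
  blocksFrom-encodeForest-below n []       r = refl
  blocksFrom-encodeForest-below n (t ∷ ts) r =
    trans (blocksFrom-encodeTree-below n t _) (blocksFrom-encodeForest-below n ts r)

  blocksFrom-encodeTree-below : ∀ n t r → blocksFrom -[1+ n ] (encodeTree below t r) ≡ blocksFrom -[1+ n ] r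
  blocksFrom-encodeTree-below n (node ts) r =
    trans (blocksFrom-D-negative n (encodeForest below ts (U ∷ r))) (blocksFrom-encodeForest-below (suc n) ts (U ∷ r))

flaws-encodeTree-below : ∀ t r → flaws (encodeTree below t r) ≡ suc (edges t + flaws r)
flaws-encodeTree-below (node ts) r = trans (flawsFrom-encodeForest-below 0 ts (U ∷ r)) (+-suc (edgesL ts) _)

flawBlocks-encodeTree-below : ∀ t r → flawBlocks (encodeTree below t r) ≡ suc (flawBlocks r)
flawBlocks-encodeTree-below (node ts) r = cong suc (blocksFrom-encodeForest-below 0 ts (U ∷ r))

mutual
  flaws-encode : ∀ t (w : Pos t) → flaws (encode t w) ≡ label w
  flaws-encode (node ts) here     = flawsFrom-encodeForest-above 0 ts []
  flaws-encode (node ts) (down q) = flaws-encodeL q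

  flaws-encodeL : ∀ {ts} (q : PosL ts) → flaws (encodeL q) ≡ suc (labelL q)
  flaws-encodeL (hd {t} {ts} w) =
    trans (flaws-encodeTree-below (node ts) (encode t w))
          (cong suc (cong₂ _+_ (edgesL≡verticesL ts) (flaws-encode t w)))
  flaws-encodeL (tl {t} q) = trans (flawsFrom-encodeTree-above 0 t _) (flaws-encodeL q)

mutual
  flawBlocks-encode : ∀ t (w : Pos t) → flawBlocks (encode t w) ≡ depth w
  flawBlocks-encode (node ts) here     = blocksFrom-encodeForest-above 0 ts []
  flawBlocks-encode (node ts) (down q) = flawBlocks-encodeL q

  flawBlocks-encodeL : ∀ {ts} (q : PosL ts) → flawBlocks (encodeL q) ≡ suc (depthL q)
  flawBlocks-encodeL (hd {t} {ts} w) =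
    trans (flawBlocks-encodeTree-below (node ts) (encode t w)) (cong suc (flawBlocks-encode t w))
  flawBlocks-encodeL (tl {t} q) = trans (blocksFrom-encodeTree-above 0 t _) (flawBlocks-encodeL q)

-- Labels and prefix edges

filter-map : ∀ {A B : Set} {P : Pred B 0ℓ} (P? : Decidable P) (f : A → B) xs →
             filter P? (map f xs) ≡ map f (filter (P? ∘ f) xs)
filter-map P? f []       = refl
filter-map P? f (x ∷ xs) with does (P? (f x))
... | true  = cong (f x ∷_) (filter-map P? f xs)
... | false = filter-map P? f xs

length-filter-map : ∀ {A B : Set} {P : Pred B 0ℓ} (P? : Decidable P) (f : A → B) xs →
                    length (filter (P? ∘ f) xs) ≡ length (filter P? (map f xs))
length-filter-map P? f xs = trans (sym (length-map f (filter (P? ∘ f) xs))) (cong length (sym (filter-map P? f xs)))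

atMost : ℕ → List ℕ → ℕ
atMost L xs = length (filter (_≤? L) xs)

atMost-++ : ∀ L xs ys → atMost L (xs ++ ys) ≡ atMost L xs + atMost L ys
atMost-++ L xs ys = trans (cong length (filter-++ (_≤? L) xs ys)) (length-++ (filter (_≤? L) xs))

atMost-shift : ∀ c L xs → atMost (c + L) (map (c +_) xs) ≡ atMost L xs
atMost-shift c L xs = begin
  atMost (c + L) (map (c +_) xs)                  ≡⟨ length-filter-map (_≤? c + L) (c +_) xs ⟨
  length (filter (λ x → c + x ≤? c + L) xs)       ≡⟨ cong length (filter-≐ _ (_≤? L) shifted xs) ⟩
  atMost L xs                                     ∎
  where
    open ≡-Reasoning
    shifted : (λ x → c + x ≤ c + L) ≐ (_≤ L)
    shifted = (λ {x} → +-cancelˡ-≤ c x L) , (λ {x} → +-monoʳ-≤ c)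

atMost-below : ∀ {c L} xs → L < c → atMost L (map (c +_) xs) ≡ 0
atMost-below {c} {L} xs L<c = begin
  atMost L (map (c +_) xs)                  ≡⟨ length-filter-map (_≤? L) (c +_) xs ⟨
  length (filter (λ x → c + x ≤? L) xs)     ≡⟨ cong length (filter-none (λ x → c + x ≤? L) (universal exceeds xs)) ⟩
  0                                         ∎
  where
    open ≡-Reasoning
    exceeds : ∀ x → ¬ c + x ≤ L
    exceeds = λ x c+x≤L → <⇒≱ L<c (m+n≤o⇒m≤o c c+x≤L)

labels : Tree → List ℕ
labels t = map label (positions t)

labelsL : List Tree → List ℕ
labelsL ts = map labelL (positionsL ts)

map-label-nonRoot : ∀ ts → map label (nonRoot (node ts)) ≡ map suc (labelsL ts)
map-label-nonRoot ts = trans (sym (map-∘ (positionsL ts))) (map-∘ (positionsL ts))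

labelsL-∷ : ∀ t ts → labelsL (t ∷ ts) ≡ map (verticesL ts +_) (labels t) ++ labelsL ts
labelsL-∷ t ts = begin
  map labelL (map hd (positions t) ++ map tl (positionsL ts))              ≡⟨ map-++ labelL (map hd (positions t)) (map tl (positionsL ts)) ⟩
  map labelL (map hd (positions t)) ++ map labelL (map tl (positionsL ts)) ≡⟨ cong₂ _++_ first (sym (map-∘ (positionsL ts))) ⟩
  map (verticesL ts +_) (labels t) ++ labelsL ts                           ∎
  where
    open ≡-Reasoning
    first : map labelL (map hd (positions t)) ≡ map (verticesL ts +_) (labels t)
    first = trans (sym (map-∘ (positions t))) (map-∘ (positions t))

mutual
  atMost-labels : ∀ L t → atMost L (labels t) ≡ suc L ⊓ suc (edges t)
  atMost-labels L (node ts) = begin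
    atMost L (0 ∷ map label (nonRoot (node ts)))          ≡⟨ cong length (filter-accept (_≤? L) {xs = map label (nonRoot (node ts))} z≤n) ⟩
    suc (atMost L (map label (nonRoot (node ts))))        ≡⟨ cong (suc ∘ atMost L) (map-label-nonRoot ts) ⟩
    suc (atMost L (map suc (labelsL ts)))                 ≡⟨ cong suc (atMost-map-suc-labelsL L ts) ⟩
    suc (L ⊓ verticesL ts)                                ≡⟨ cong (suc ∘ (L ⊓_)) (edgesL≡verticesL ts) ⟨
    suc L ⊓ suc (edgesL ts)                               ∎
    where open ≡-Reasoning

  atMost-map-suc-labelsL : ∀ L ts → atMost L (map suc (labelsL ts)) ≡ L ⊓ verticesL ts
  atMost-map-suc-labelsL zero    ts = atMost-below (labelsL ts) (s≤s z≤n)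
  atMost-map-suc-labelsL (suc L) ts = trans (atMost-shift 1 L (labelsL ts)) (atMost-labelsL L ts)

  atMost-labelsL : ∀ L ts → atMost L (labelsL ts) ≡ suc L ⊓ verticesL ts
  atMost-labelsL L []       = refl
  atMost-labelsL L (t ∷ ts) = begin
    atMost L (labelsL (t ∷ ts))                                         ≡⟨ cong (atMost L) (labelsL-∷ t ts) ⟩
    atMost L (map (verticesL ts +_) (labels t) ++ labelsL ts)           ≡⟨ atMost-++ L (map (verticesL ts +_) (labels t)) (labelsL ts) ⟩
    atMost L (map (verticesL ts +_) (labels t)) + atMost L (labelsL ts) ≡⟨ cong (atMost L (map (verticesL ts +_) (labels t)) +_) (atMost-labelsL L ts) ⟩
    atMost L (map (verticesL ts +_) (labels t)) + suc L ⊓ verticesL ts  ≡⟨ atMost-labelsL-∷ L t ts ⟩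
    suc L ⊓ (suc (edges t) + verticesL ts)                              ∎
    where open ≡-Reasoning

  atMost-labelsL-∷ : ∀ L t ts → atMost L (map (verticesL ts +_) (labels t)) + suc L ⊓ verticesL ts
                                ≡ suc L ⊓ (suc (edges t) + verticesL ts)
  atMost-labelsL-∷ L t ts with L <? verticesL ts
  ... | yes L<V = begin
    atMost L (map (verticesL ts +_) (labels t)) + suc L ⊓ verticesL ts ≡⟨ cong (_+ suc L ⊓ verticesL ts) (atMost-below (labels t) L<V) ⟩
    suc L ⊓ verticesL ts                                               ≡⟨ m≤n⇒m⊓n≡m L<V ⟩
    suc L                                                              ≡⟨ m≤n⇒m⊓n≡m (≤-trans L<V (m≤n+m (verticesL ts) (suc (edges t)))) ⟨
    suc L ⊓ (suc (edges t) + verticesL ts)                             ∎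
    where open ≡-Reasoning
  ... | no L≮V with m≤n⇒∃[o]m+o≡n (≮⇒≥ L≮V)
  ...   | d , refl = begin
    atMost (V + d) (map (V +_) (labels t)) + suc (V + d) ⊓ V ≡⟨ cong₂ _+_ (atMost-shift V d (labels t)) (m≥n⇒m⊓n≡n (≤-trans (m≤m+n V d) (n≤1+n _))) ⟩
    atMost d (labels t) + V                                  ≡⟨ cong (_+ V) (atMost-labels d t) ⟩
    suc d ⊓ suc (edges t) + V                                ≡⟨ +-distribʳ-⊓ V (suc d) (suc (edges t)) ⟩
    (suc d + V) ⊓ (suc (edges t) + V)                        ≡⟨ cong (λ x → suc x ⊓ (suc (edges t) + V)) (+-comm d V) ⟩
    suc (V + d) ⊓ (suc (edges t) + V)                        ∎
    where
      open ≡-Reasoning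
      V : ℕ
      V = verticesL ts

mutual
  label≤edges : ∀ {t} (w : Pos t) → label w ≤ edges t
  label≤edges {node ts} here     = z≤n
  label≤edges {node ts} (down q) = subst (labelL q <_) (sym (edgesL≡verticesL ts)) (labelL<verticesL q)

  labelL<verticesL : ∀ {ts} (q : PosL ts) → labelL q < verticesL ts
  labelL<verticesL (hd {t} {ts} w) = s≤s (≤-trans (+-monoʳ-≤ (verticesL ts) (label≤edges w)) (≤-reflexive (+-comm (verticesL ts) _)))
  labelL<verticesL (tl {t} {ts} q) = ≤-trans (labelL<verticesL q) (m≤n+m (verticesL ts) (suc (edges t)))

prefixEdges≡label : ∀ t (w : Pos t) → prefixEdges t w ≡ label w
prefixEdges≡label (node ts) w = begin
  prefixEdges (node ts) w                          ≡⟨ length-filter-map (_≤? label w) label (nonRoot (node ts)) ⟩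
  atMost (label w) (map label (nonRoot (node ts))) ≡⟨ cong (atMost (label w)) (map-label-nonRoot ts) ⟩
  atMost (label w) (map suc (labelsL ts))          ≡⟨ atMost-map-suc-labelsL (label w) ts ⟩
  label w ⊓ verticesL ts                           ≡⟨ m≤n⇒m⊓n≡m (subst (label w ≤_) (edgesL≡verticesL ts) (label≤edges w)) ⟩
  label w                                          ∎
  where open ≡-Reasoning

-- Decoding

raise : ∀ ls {ts} → PosL ts → PosL (ls ++ ts)
raise []       q = q
raise (t ∷ ls) q = tl (raise ls q)

encodeL-raise : ∀ ls {ts} (q : PosL ts) → encodeL (raise ls q) ≡ encodeForest above ls (encodeL q)
encodeL-raise []       q = refl
encodeL-raise (t ∷ ls) q = cong (encodeTree above t) (encodeL-raise ls q)

raise-∷ʳ : ∀ ls t {ts} (q : PosL ts) →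
           _≡_ {A = Σ (List Tree) PosL} ((ls ++ [ t ]) ++ ts , raise (ls ++ [ t ]) q) (ls ++ t ∷ ts , raise ls (tl q))
raise-∷ʳ []       t q = refl
raise-∷ʳ (l ∷ ls) t q = cong (λ { (xs , p) → l ∷ xs , tl p }) (raise-∷ʳ ls t q)

graft : List Tree → List Tree → Σ Tree Pos → Σ Tree Pos
graft ls rs (t , w) = node (ls ++ t ∷ rs) , down (raise ls (hd w))

fallback : Σ Tree Pos
fallback = node [] , here

-- The fuel of decode bounds the stem length; fallback is returned on words that
-- encode no doubly rooted tree.
mutual
  decode : ℕ → List Step → Σ Tree Pos
  decode zero    s = fallback
  decode (suc f) s = decodeAbove f (parseForest above (length s) s)

  decodeAbove : ℕ → List Tree × List Step → Σ Tree Pos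
  decodeAbove f (ls , [])    = node ls , here
  decodeAbove f (ls , U ∷ r) = fallback
  decodeAbove f (ls , D ∷ r) = decodeBelow f ls (parseForest below (length r) r)

  decodeBelow : ℕ → List Tree → List Tree × List Step → Σ Tree Pos
  decodeBelow f ls (rs , U ∷ r) = graft ls rs (decode f r)
  decodeBelow f ls (rs , _)     = fallback

parse-encodeForest : ∀ σ ts r → Stops σ r → parseForest σ (length (encodeForest σ ts r)) (encodeForest σ ts r) ≡ (ts , r)
parse-encodeForest σ ts r = parseForest-encodeForest σ _ ts r (edgesL≤length-encodeForest σ ts r)

mutual
  decode-encode : ∀ f t (w : Pos t) → depth w < f → decode f (encode t w) ≡ (t , w)
  decode-encode zero    t         w        ()
  decode-encode (suc f) (node ts) here     _         = cong (decodeAbove f) (parse-encodeForest above ts [] end)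
  decode-encode (suc f) (node ts) (down q) (s≤s lt) = decode-encodeL f [] q lt

  decode-encodeL : ∀ f ls {ts} (q : PosL ts) → depthL q < f →
                   decode (suc f) (encodeForest above ls (encodeL q)) ≡ (node (ls ++ ts) , down (raise ls q))
  decode-encodeL f ls (hd {t} {rs} w) lt = begin
    decodeAbove f (parseForest above (length word) word)                   ≡⟨ cong (decodeAbove f) (parse-encodeForest above ls (D ∷ rest) atClosing) ⟩
    decodeBelow f ls (parseForest below (length rest) rest)                ≡⟨ cong (decodeBelow f ls) (parse-encodeForest below rs (U ∷ encode t w) atClosing) ⟩
    graft ls rs (decode f (encode t w))                                    ≡⟨ cong (graft ls rs) (decode-encode f t w lt) ⟩
    graft ls rs (t , w)                                                    ∎
    where
      open ≡-Reasoning
      rest word : List Step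
      rest = encodeForest below rs (U ∷ encode t w)
      word = encodeForest above ls (D ∷ rest)
  decode-encodeL f ls (tl {t} q) lt = begin
    decode (suc f) (encodeForest above ls (encodeTree above t (encodeL q))) ≡⟨ cong (decode (suc f)) (encodeForest-++ above ls [ t ] (encodeL q)) ⟨
    decode (suc f) (encodeForest above (ls ++ [ t ]) (encodeL q))           ≡⟨ decode-encodeL f (ls ++ [ t ]) q lt ⟩
    (node ((ls ++ [ t ]) ++ _) , down (raise (ls ++ [ t ]) q))              ≡⟨ cong (λ { (xs , p) → node xs , down p }) (raise-∷ʳ ls t q) ⟩
    (node (ls ++ t ∷ _) , down (raise ls (tl q)))                           ∎
    where open ≡-Reasoning

mutual
  encode-decode : ∀ f s → Rises 0 s → flawBlocks s < f → uncurry encode (decode f s) ≡ s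
  encode-decode zero    s _        ()
  encode-decode (suc f) s balanced lt =
    encode-decodeAbove f (proj₁ parsed) (proj₂ parsed) (encodeForest-parseForest above (length s) s)
                       (parseForest-halted above (length s) s ≤-refl) balanced lt
    where
      parsed : List Tree × List Step
      parsed = parseForest above (length s) s

  encode-decodeAbove : ∀ f {s} ls r → encodeForest above ls r ≡ s → Halted above r →
                       Rises 0 s → flawBlocks s < suc f → uncurry encode (decodeAbove f (ls , r)) ≡ s
  encode-decodeAbove f ls r refl halted balanced lt
    with halted-balanced above halted (≤-reflexive (rises-encodeForest above ls r balanced))
  ... | end                = refl
  ... | atClosing {r = r′} =
    encode-decodeBelow f ls (proj₁ parsed) (proj₂ parsed) (encodeForest-parseForest below (length r′) r′)
                       (parseForest-halted below (length r′) r′ ≤-refl) (rises-encodeForest above ls r balanced) lt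
    where
      parsed : List Tree × List Step
      parsed = parseForest below (length r′) r′

  encode-decodeBelow : ∀ f ls {r} rs r′ → encodeForest below rs r′ ≡ r → Halted below r′ →
                       Rises 1 r → flawBlocks (encodeForest above ls (D ∷ r)) < suc f →
                       uncurry encode (decodeBelow f ls (rs , r′)) ≡ encodeForest above ls (D ∷ r)
  encode-decodeBelow f ls rs r′ refl halted rises lt
    with halted-balanced below halted (≤-trans (n≤1+n _) (≤-reflexive (sym (rises-encodeForest below rs r′ rises))))
  ... | end                = ⊥-elim (0≢1+n (rises-encodeForest below rs [] rises))
  ... | atClosing {r = r″} = begin
    encodeL (raise ls (hd (proj₂ (decode f r″))))                                     ≡⟨ encodeL-raise ls (hd (proj₂ (decode f r″))) ⟩
    encodeForest above ls (encodeTree below (node rs) (uncurry encode (decode f r″))) ≡⟨ cong (encodeForest above ls ∘ encodeTree below (node rs)) (encode-decode f r″ balanced fewer) ⟩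
    encodeForest above ls (encodeTree below (node rs) r″)                             ∎
    where
      open ≡-Reasoning
      balanced : Rises 0 r″
      balanced = suc-injective (rises-encodeForest below rs (U ∷ r″) rises)
      fewer : flawBlocks r″ < f
      fewer = s≤s⁻¹ (subst (_< suc f) (trans (blocksFrom-encodeForest-above 0 ls _) (flawBlocks-encodeTree-below (node rs) r″)) lt)

freeDyck-rises : ∀ {n} s → length s ≡ 2 * n → ups s ≡ n → Rises 0 s
freeDyck-rises {n} s len up = trans ups≡n (sym downs≡n)
  where
    open ≡-Reasoning
    ups≡n : count U s ≡ n
    ups≡n = trans (sym (ups≡count s)) up
    downs≡n : count D s ≡ n
    downs≡n = +-cancelˡ-≡ n _ _ (begin
      n + count D s          ≡⟨ cong (_+ count D s) ups≡n ⟨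
      count U s + count D s  ≡⟨ length≡count+count s ⟨
      length s               ≡⟨ len ⟩
      n + (n + 0)            ≡⟨ cong (n +_) (+-identityʳ n) ⟩
      n + n                  ∎)

freeDyck-≡ : ∀ {n m k} {x y : FreeDyck n m k} → proj₁ x ≡ proj₁ y → x ≡ y
freeDyck-≡ {x = s , a , b , c , d} {y = .s , a′ , b′ , c′ , d′} refl
  rewrite ≡-irrelevant a a′ | ≡-irrelevant b b′ | ≡-irrelevant c c′ | ≡-irrelevant d d′ = refl

drTree-≡ : ∀ {n k m} {x y : DRTree n k m} →
           _≡_ {A = Σ Tree Pos} (proj₁ x , proj₁ (proj₂ x)) (proj₁ y , proj₁ (proj₂ y)) → x ≡ y
drTree-≡ {x = t , w , a , b , c} {y = .t , .w , a′ , b′ , c′} refl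
  rewrite ≡-irrelevant a a′ | ≡-irrelevant b b′ | ≡-irrelevant c c′ = refl

module _ {n m k : ℕ} where

  decodePath : FreeDyck n m k → Σ Tree Pos
  decodePath (s , _) = decode (suc (flawBlocks s)) s

  encode-decodePath : ∀ (x : FreeDyck n m k) → uncurry encode (decodePath x) ≡ proj₁ x
  encode-decodePath (s , len , up , _) = encode-decode (suc (flawBlocks s)) s (freeDyck-rises s len up) ≤-refl

  pathToTree : FreeDyck n m k → DRTree n k m
  pathToTree x@(s , _ , up , fl , bl) = t , w , edges≡n , depth≡k , prefix≡m
    where
      t : Tree
      t = proj₁ (decodePath x)
      w : Pos t
      w = proj₂ (decodePath x)
      encoded : encode t w ≡ s
      encoded = encode-decodePath x
      edges≡n : edges t ≡ n
      edges≡n = trans (sym (count-encode U t w)) (trans (cong (count U) encoded) (trans (sym (ups≡count s)) up))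
      depth≡k : depth w ≡ k
      depth≡k = trans (sym (flawBlocks-encode t w)) (trans (cong flawBlocks encoded) bl)
      prefix≡m : prefixEdges t w ≡ m
      prefix≡m = trans (prefixEdges≡label t w) (trans (sym (flaws-encode t w)) (trans (cong flaws encoded) fl))

  treeToPath : DRTree n k m → FreeDyck n m k
  treeToPath (t , w , e , d , p) = encode t w , length≡2n , ups≡n , flaws≡m , blocks≡k
    where
      open ≡-Reasoning
      length≡2n : length (encode t w) ≡ 2 * n
      length≡2n = begin
        length (encode t w)                         ≡⟨ length≡count+count (encode t w) ⟩
        count U (encode t w) + count D (encode t w) ≡⟨ cong₂ _+_ (count-encode U t w) (count-encode D t w) ⟩
        edges t + edges t                           ≡⟨ cong₂ _+_ e (trans e (sym (+-identityʳ n))) ⟩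
        2 * n                                       ∎
      ups≡n : ups (encode t w) ≡ n
      ups≡n = trans (ups≡count (encode t w)) (trans (count-encode U t w) e)
      flaws≡m : flaws (encode t w) ≡ m
      flaws≡m = trans (flaws-encode t w) (trans (sym (prefixEdges≡label t w)) p)
      blocks≡k : flawBlocks (encode t w) ≡ k
      blocks≡k = trans (flawBlocks-encode t w) d

  pathToTree-treeToPath : ∀ y → pathToTree (treeToPath y) ≡ y
  pathToTree-treeToPath (t , w , _) =
    drTree-≡ (decode-encode (suc (flawBlocks (encode t w))) t w (s≤s (≤-reflexive (sym (flawBlocks-encode t w)))))

  treeToPath-pathToTree : ∀ x → treeToPath (pathToTree x) ≡ x
  treeToPath-pathToTree x = freeDyck-≡ (encode-decodePath x)

theorem3p3 : (n m k : ℕ) → k ≤ m → m ≤ n → FreeDyck n m k ⤖ DRTree n k m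
theorem3p3 n m k _ _ = ↔⇒⤖ (mk↔ₛ′ pathToTree treeToPath pathToTree-treeToPath treeToPath-pathToTree)
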